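{- Let $(X,\rho)$ be a represented space and $(\mathfrak{B},\beta)$ a Lacombe base of $(X,\rho)$ such that Local Overt Choice $\mathrm{OVC}_{\mathfrak{B}}$ is computable. Then $(\mathfrak{B},\beta)$ is a Nogina base of $(X,\rho)$.
   Context: A represented space is a set with a partial surjection from Baire space; computability of (multi)functions via realizers; final topology. For a represented space $Z$: $\mathcal{O}(Z)$ is its set of open sets represented by names of characteristic maps into Sierpiński space; $\mathcal{V}(Z)$ is its set of closed sets $A$, named by $\mathcal{O}(\mathcal{O}(Z))$-names of $\{O: O\cap A\neq\emptyset\}$. Local Overt Choice on $Z$ is the multifunction $\mathrm{OVC}_Z:\subseteq\mathcal{V}(Z)\times\mathcal{O}(Z)\rightrightarrows Z$, $(V,U)\mapsto V\cap U$, defined when $V\cap U\neq\emptyset$. Let $\mathfrak{B}\subseteq\mathcal{O}(X)$ with representation $\beta$. $(\mathfrak{B},\beta)$ is a semi-effective base if the inclusion $\mathfrak{B}\hookrightarrow\mathcal{O}(X)$ is computable and $\mathfrak{B}$ is a base of the topology. It is a Lacombe base if moreover the map $\mathcal{V}(\mathfrak{B})\to\mathcal{O}(X)$, $A\mapsto\bigcup_{b\in A}b$, is onto and has a computable multivalued right inverse. It is a Nogina base if it is a semi-effective base and the multifunction $N:\subseteq X\times\mathcal{O}(X)\rightrightarrows\mathfrak{B}$, $(x,O)\mapsto\{B\in\mathfrak{B}: x\in B\subseteq O\}$, defined when $x\in O$, is computable. -}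

module Defs where

open import Level using (Level; _⊔_; 0ℓ) renaming (suc to lsuc)
open import Data.Nat using (ℕ; zero; suc; _+_; _*_; _<_)
open import Data.Fin using (Fin)
open import Data.Vec using (Vec; []; _∷_; lookup)
open import Data.List using (List; []; _∷_)
open import Data.Product using (Σ; Σ-syntax; _×_; _,_; proj₁; proj₂)
open import Data.Unit using (⊤)
open import Relation.Nullary using (¬_)
open import Relation.Unary using (Pred)
open import Relation.Binary using (Rel; IsEquivalence)
open import Relation.Binary.PropositionalEquality using (_≡_)

Baire : Set
Baire = ℕ → ℕ

data Code : ℕ → Set where
  zer  : ∀ {n} → Code n
  succ : Code 1
  proj : ∀ {n} → Fin n → Code n
  comp : ∀ {n k} → Code k → Vec (Code n) k → Code n
  prec : ∀ {n} → Code n → Code (suc (suc n)) → Code (suc n)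
  mu   : ∀ {n} → Code (suc n) → Code n

mutual
  data _[_]⇓_ : ∀ {n} → Code n → Vec ℕ n → ℕ → Set where
    ev-zer  : ∀ {n} {xs : Vec ℕ n} → zer [ xs ]⇓ 0
    ev-succ : ∀ {x} → succ [ x ∷ [] ]⇓ suc x
    ev-proj : ∀ {n} {i : Fin n} {xs} → proj i [ xs ]⇓ lookup xs i
    ev-comp : ∀ {n k} {f : Code k} {gs : Vec (Code n) k} {xs ys y} →
              gs [ xs ]⇓* ys → f [ ys ]⇓ y → comp f gs [ xs ]⇓ y
    ev-prec0 : ∀ {n} {f : Code n} {g : Code (suc (suc n))} {xs y} →
               f [ xs ]⇓ y → prec f g [ 0 ∷ xs ]⇓ y
    ev-precS : ∀ {n} {f : Code n} {g : Code (suc (suc n))} {xs m r y} →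
               prec f g [ m ∷ xs ]⇓ r → g [ m ∷ r ∷ xs ]⇓ y →
               prec f g [ suc m ∷ xs ]⇓ y
    ev-mu   : ∀ {n} {f : Code (suc n)} {xs y} →
              f [ y ∷ xs ]⇓ 0 →
              (∀ j → j < y → Σ[ v ∈ ℕ ] (f [ j ∷ xs ]⇓ suc v)) →
              mu f [ xs ]⇓ y

  data _[_]⇓*_ : ∀ {n k} → Vec (Code n) k → Vec ℕ n → Vec ℕ k → Set where
    ev-[] : ∀ {n} {xs : Vec ℕ n} → [] [ xs ]⇓* []
    ev-∷  : ∀ {n k} {g : Code n} {gs : Vec (Code n) k} {xs y ys} →
            g [ xs ]⇓ y → gs [ xs ]⇓* ys → (g ∷ gs) [ xs ]⇓* (y ∷ ys)

IsComputable : Baire → Set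
IsComputable α = Σ[ e ∈ Code 1 ] (∀ n → e [ n ∷ [] ]⇓ α n)

tri : ℕ → ℕ
tri zero = zero
tri (suc n) = suc n + tri n

pair : ℕ → ℕ → ℕ
pair a b = tri (a + b) + b

codeList : List ℕ → ℕ
codeList [] = 0
codeList (x ∷ xs) = suc (pair x (codeList xs))

-- the first k values of p (in reverse order)
prefix : ℕ → Baire → List ℕ
prefix zero p = []
prefix (suc k) p = p k ∷ prefix k p

-- Assoc α p q : the partial function with associate α maps p to q
Assoc : Baire → Baire → Baire → Set
Assoc α p q = ∀ n → Σ[ k ∈ ℕ ]
  ( (α (pair n (codeList (prefix k p))) ≡ suc (q n))
  × (∀ j → j < k → α (pair n (codeList (prefix j p))) ≡ 0) )

-- Sierpinski space: a name r denotes ⊤ iff it contains a nonzero entry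
Sier : Baire → Set
Sier r = Σ[ n ∈ ℕ ] ¬ (r n ≡ 0)

-- Represented spaces (carrier with equality; δ p x : "p is a name of x")

record RepSpace (c ℓ d : Level) : Set (lsuc (c ⊔ ℓ ⊔ d)) where
  field
    Carrier : Set c
    _≈_     : Rel Carrier ℓ
    δ       : Baire → Carrier → Set d

open RepSpace public

-- δ is a partial surjection Baire ⇀ Carrier (w.r.t. the equality _≈_)
IsRepresentation : ∀ {c ℓ d} → RepSpace c ℓ d → Set (c ⊔ ℓ ⊔ d)
IsRepresentation Z =
    IsEquivalence (_≈_ Z)
  × (∀ {p x y} → _≈_ Z x y → δ Z p x → δ Z p y)
  × (∀ {p x y} → δ Z p x → δ Z p y → _≈_ Z x y)
  × (∀ x → Σ[ p ∈ Baire ] δ Z p x)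

Respects : ∀ {c ℓ d a} (Z : RepSpace c ℓ d) → Pred (Carrier Z) a → Set (c ⊔ ℓ ⊔ a)
Respects Z U = ∀ {x y} → _≈_ Z x y → U x → U y

-- p is a name of the characteristic map U → Sierpinski space
OpenName : ∀ {c ℓ d a} (Z : RepSpace c ℓ d) → Pred (Carrier Z) a → Baire → Set (c ⊔ d ⊔ a)
OpenName Z U p = ∀ q z → δ Z q z →
  Σ[ r ∈ Baire ] (Assoc p q r × ((U z → Sier r) × (Sier r → U z)))

IsOpen : ∀ {c ℓ d a} (Z : RepSpace c ℓ d) → Pred (Carrier Z) a → Set (c ⊔ d ⊔ a)
IsOpen Z U = Σ[ p ∈ Baire ] OpenName Z U p

𝒪 : ∀ {c ℓ d} → RepSpace c ℓ d → RepSpace (lsuc (c ⊔ ℓ ⊔ d)) (c ⊔ ℓ ⊔ d) (c ⊔ ℓ ⊔ d)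
𝒪 {c} {ℓ} {d} Z = record
  { Carrier = Σ[ U ∈ Pred (Carrier Z) (c ⊔ ℓ ⊔ d) ] (Respects Z U × IsOpen Z U)
  ; _≈_ = λ U V → ∀ z → (proj₁ U z → proj₁ V z) × (proj₁ V z → proj₁ U z)
  ; δ = λ p U → OpenName Z (proj₁ U) p
  }

Meets : ∀ {c ℓ d a} (Z : RepSpace c ℓ d) → Pred (Carrier Z) a → Pred (Carrier (𝒪 Z)) (c ⊔ ℓ ⊔ d ⊔ a)
Meets Z A O = Σ[ z ∈ Carrier Z ] (proj₁ O z × A z)

-- V(Z): closed sets A, named by O(O(Z))-names of {O : O ∩ A ≠ ∅}
𝒱 : ∀ {c ℓ d} → RepSpace c ℓ d → RepSpace (lsuc (c ⊔ ℓ ⊔ d)) (c ⊔ ℓ ⊔ d) (lsuc (c ⊔ ℓ ⊔ d))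
𝒱 {c} {ℓ} {d} Z = record
  { Carrier = Σ[ A ∈ Pred (Carrier Z) (c ⊔ ℓ ⊔ d) ]
      (Respects Z A × IsOpen Z (λ z → ¬ A z) × IsOpen (𝒪 Z) (Meets Z A))
  ; _≈_ = λ A B → ∀ z → (proj₁ A z → proj₁ B z) × (proj₁ B z → proj₁ A z)
  ; δ = λ p A → OpenName (𝒪 Z) (Meets Z (proj₁ A)) p
  }

evens odds : Baire → Baire
evens p n = p (2 * n)
odds p n = p (suc (2 * n))

_⊗_ : ∀ {c ℓ d c' ℓ' d'} → RepSpace c ℓ d → RepSpace c' ℓ' d' →
      RepSpace (c ⊔ c') (ℓ ⊔ ℓ') (d ⊔ d')
A ⊗ B = record
  { Carrier = Carrier A × Carrier B
  ; _≈_ = λ x y → _≈_ A (proj₁ x) (proj₁ y) × _≈_ B (proj₂ x) (proj₂ y)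
  ; δ = λ p x → δ A (evens p) (proj₁ x) × δ B (odds p) (proj₂ x)
  }

Computable : ∀ {c ℓ d c' ℓ' d' e f} (A : RepSpace c ℓ d) (B : RepSpace c' ℓ' d') →
             Pred (Carrier A) e → (Carrier A → Carrier B → Set f) →
             Set (c ⊔ d ⊔ c' ⊔ d' ⊔ e ⊔ f)
Computable A B dom R = Σ[ α ∈ Baire ] (IsComputable α ×
  (∀ p a → δ A p a → dom a →
     Σ[ q ∈ Baire ] (Assoc α p q × Σ[ b ∈ Carrier B ] (δ B q b × R a b))))

BaseSpace : ∀ {c ℓ d b e} (X : RepSpace c ℓ d) (P : Pred (Carrier (𝒪 X)) b) →
            (Baire → Σ (Carrier (𝒪 X)) P → Set e) →
            RepSpace (lsuc (c ⊔ ℓ ⊔ d) ⊔ b) (c ⊔ ℓ ⊔ d) e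
BaseSpace X P β = record
  { Carrier = Σ (Carrier (𝒪 X)) P
  ; _≈_ = λ B B' → _≈_ (𝒪 X) (proj₁ B) (proj₁ B')
  ; δ = β
  }

IsBase : ∀ {c ℓ d b} (X : RepSpace c ℓ d) (P : Pred (Carrier (𝒪 X)) b) → Set _
IsBase X P = ∀ (U : Carrier (𝒪 X)) x → proj₁ U x →
  Σ[ B ∈ Carrier (𝒪 X) ] (P B × proj₁ B x × (∀ y → proj₁ B y → proj₁ U y))

SemiEffectiveBase : ∀ {c ℓ d b e} (X : RepSpace c ℓ d) (P : Pred (Carrier (𝒪 X)) b) →
                    (Baire → Σ (Carrier (𝒪 X)) P → Set e) → Set _
SemiEffectiveBase X P β =
    Computable (BaseSpace X P β) (𝒪 X) (λ _ → ⊤) (λ B U → _≈_ (𝒪 X) (proj₁ B) U)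
  × IsBase X P

-- the union map V(𝔅) → O(X) is onto with a computable multivalued right inverse
LacombeBase : ∀ {c ℓ d b e} (X : RepSpace c ℓ d) (P : Pred (Carrier (𝒪 X)) b) →
              (Baire → Σ (Carrier (𝒪 X)) P → Set e) → Set _
LacombeBase X P β =
    SemiEffectiveBase X P β
  × Computable (𝒪 X) (𝒱 (BaseSpace X P β)) (λ _ → ⊤)
      (λ U A → ∀ x → (proj₁ U x → Σ[ B ∈ Σ (Carrier (𝒪 X)) P ] (proj₁ A B × proj₁ (proj₁ B) x))
                   × (Σ[ B ∈ Σ (Carrier (𝒪 X)) P ] (proj₁ A B × proj₁ (proj₁ B) x) → proj₁ U x))

NoginaBase : ∀ {c ℓ d b e} (X : RepSpace c ℓ d) (P : Pred (Carrier (𝒪 X)) b) →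
             (Baire → Σ (Carrier (𝒪 X)) P → Set e) → Set _
NoginaBase X P β =
    SemiEffectiveBase X P β
  × Computable (X ⊗ 𝒪 X) (BaseSpace X P β)
      (λ xO → proj₁ (proj₂ xO) (proj₁ xO))
      (λ xO B → proj₁ (proj₁ B) (proj₁ xO) × (∀ y → proj₁ (proj₁ B) y → proj₁ (proj₂ xO) y))

OVCComputable : ∀ {c ℓ d} (Z : RepSpace c ℓ d) → Set _
OVCComputable Z =
  Computable (𝒱 Z ⊗ 𝒪 Z) Z
    (λ VU → Σ[ z ∈ Carrier Z ] (proj₁ (proj₁ VU) z × proj₁ (proj₂ VU) z))
    (λ VU z → proj₁ (proj₁ VU) z × proj₁ (proj₂ VU) z)

module Submission where

-- Given names of x and of an open O ∋ x, compute a name of a Lacombe cover A ∈ 𝒱(𝔅) of O and a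
-- name of the open set {B ∈ 𝔅 : x ∈ B} ∈ 𝒪(𝔅). They meet because x ∈ O = ⋃A, so local overt
-- choice returns a basic B ∈ A with x ∈ B, and B ⊆ ⋃A = O. The second name exists because the
-- inclusion 𝔅 → 𝒪(X) is computable: x ∈ B is semi-decided by running the 𝒪(X)-name of B on the
-- name of x, dovetailed over prefixes of the names of B and x.

open import Defs
open import Level using (Level; Lift; lift; lower) renaming (_⊔_ to _⊔ˡ_; suc to lsuc)
open import Data.Nat hiding (parity)
open import Data.Nat.Properties
open import Data.Nat.Tactic.RingSolver using (solve-∀)
open import Data.Vec using (Vec; []; _∷_; lookup; head; tail)
open import Data.Fin using (Fin) renaming (zero to fz; suc to fs)
open import Data.Product
open import Data.Empty using (⊥-elim)
open import Data.Unit using (⊤; tt)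
open import Relation.Nullary using (yes; no)
open import Relation.Unary using (Pred)
open import Relation.Binary.PropositionalEquality
open import Relation.Binary.Definitions using (tri<; tri≈; tri>)

Recursive : ∀ {n} → (Vec ℕ n → ℕ) → Set
Recursive {n} f = Σ[ c ∈ Code n ] (∀ xs → c [ xs ]⇓ f xs)

Recursive-ext : ∀ {n} {f g : Vec ℕ n → ℕ} → (∀ xs → f xs ≡ g xs) → Recursive f → Recursive g
Recursive-ext f≗g (c , c⇓f) = c , λ xs → subst (c [ xs ]⇓_) (f≗g xs) (c⇓f xs)

-- Records rather than definitions, so that F can be inferred from the type.
record Recursive₁ (F : ℕ → ℕ) : Set where
  constructor rec₁
  field code : Recursive {1} (λ xs → F (lookup xs fz))

record Recursive₂ (F : ℕ → ℕ → ℕ) : Set where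
  constructor rec₂
  field code : Recursive {2} (λ xs → F (lookup xs fz) (lookup xs (fs fz)))

record Recursive₃ (F : ℕ → ℕ → ℕ → ℕ) : Set where
  constructor rec₃
  field code : Recursive {3} (λ xs → F (lookup xs fz) (lookup xs (fs fz)) (lookup xs (fs (fs fz))))

record Recursive₄ (F : ℕ → ℕ → ℕ → ℕ → ℕ) : Set where
  constructor rec₄
  field code : Recursive {4} (λ xs → F (lookup xs fz) (lookup xs (fs fz)) (lookup xs (fs (fs fz)))
                                        (lookup xs (fs (fs (fs fz)))))

var : ∀ {n} (i : Fin n) → Recursive (λ xs → lookup xs i)
var i = proj i , λ _ → ev-proj

var₀ : ∀ {n} → Recursive {suc n} (λ xs → lookup xs fz)
var₀ = var fz

var₁ : ∀ {n} → Recursive {suc (suc n)} (λ xs → lookup xs (fs fz))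
var₁ = var (fs fz)

var₂ : ∀ {n} → Recursive {suc (suc (suc n))} (λ xs → lookup xs (fs (fs fz)))
var₂ = var (fs (fs fz))

var₃ : ∀ {n} → Recursive {suc (suc (suc (suc n)))} (λ xs → lookup xs (fs (fs (fs fz))))
var₃ = var (fs (fs (fs fz)))

ap₁ : ∀ {n F} {g : Vec ℕ n → ℕ} → Recursive₁ F → Recursive g → Recursive (λ xs → F (g xs))
ap₁ (rec₁ (cF , F⇓)) (cg , g⇓) = comp cF (cg ∷ []) , λ xs → ev-comp (ev-∷ (g⇓ xs) ev-[]) (F⇓ _)

ap₂ : ∀ {n F} {g h : Vec ℕ n → ℕ} → Recursive₂ F → Recursive g → Recursive h →
      Recursive (λ xs → F (g xs) (h xs))
ap₂ (rec₂ (cF , F⇓)) (cg , g⇓) (ch , h⇓) =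
  comp cF (cg ∷ ch ∷ []) , λ xs → ev-comp (ev-∷ (g⇓ xs) (ev-∷ (h⇓ xs) ev-[])) (F⇓ _)

ap₃ : ∀ {n F} {g h k : Vec ℕ n → ℕ} → Recursive₃ F → Recursive g → Recursive h → Recursive k →
      Recursive (λ xs → F (g xs) (h xs) (k xs))
ap₃ (rec₃ (cF , F⇓)) (cg , g⇓) (ch , h⇓) (ck , k⇓) =
  comp cF (cg ∷ ch ∷ ck ∷ []) ,
  λ xs → ev-comp (ev-∷ (g⇓ xs) (ev-∷ (h⇓ xs) (ev-∷ (k⇓ xs) ev-[]))) (F⇓ _)

rec-suc : Recursive₁ suc
rec-suc = rec₁ (succ , λ { (_ ∷ []) → ev-succ })

const : ∀ {n} k → Recursive {n} (λ _ → k)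
const zero = zer , λ _ → ev-zer
const (suc k) = ap₁ rec-suc (const k)

primRecVec : ∀ {n} → (Vec ℕ n → ℕ) → (Vec ℕ (suc (suc n)) → ℕ) → ℕ → Vec ℕ n → ℕ
primRecVec f g zero xs = f xs
primRecVec f g (suc m) xs = g (m ∷ primRecVec f g m xs ∷ xs)

rec-primRecVec : ∀ {n} {f : Vec ℕ n → ℕ} {g} → Recursive f → Recursive g →
                 Recursive (λ xs → primRecVec f g (head xs) (tail xs))
rec-primRecVec {f = f} {g} (cf , f⇓) (cg , g⇓) = prec cf cg , λ { (m ∷ xs) → prec⇓ m xs }
  where
  prec⇓ : ∀ m xs → prec cf cg [ m ∷ xs ]⇓ primRecVec f g m xs
  prec⇓ zero xs = ev-prec0 (f⇓ xs)
  prec⇓ (suc m) xs = ev-precS (prec⇓ m xs) (g⇓ _)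

rec-primRec₀ : ∀ {F : ℕ → ℕ} {b g} → F 0 ≡ b → (∀ m → F (suc m) ≡ g m (F m)) →
               Recursive₂ g → Recursive₁ F
rec-primRec₀ {F} {b} {g} F0 FS (rec₂ g⇓) =
  rec₁ (Recursive-ext (λ { (m ∷ []) → agree m }) (rec-primRecVec (const b) g⇓))
  where
  agree : ∀ m → primRecVec (λ _ → b) (λ xs → g (lookup xs fz) (lookup xs (fs fz))) m [] ≡ F m
  agree zero = sym F0
  agree (suc m) = trans (cong (g m) (agree m)) (sym (FS m))

rec-primRec₁ : ∀ {F : ℕ → ℕ → ℕ} {f g} → (∀ x → F 0 x ≡ f x) →
               (∀ m x → F (suc m) x ≡ g m (F m x) x) →
               Recursive₁ f → Recursive₃ g → Recursive₂ F
rec-primRec₁ {F} {f} {g} F0 FS (rec₁ f⇓) (rec₃ g⇓) =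
  rec₂ (Recursive-ext (λ { (m ∷ x ∷ []) → agree m x }) (rec-primRecVec f⇓ g⇓))
  where
  agree : ∀ m x → primRecVec (λ xs → f (lookup xs fz))
                    (λ xs → g (lookup xs fz) (lookup xs (fs fz)) (lookup xs (fs (fs fz))))
                    m (x ∷ []) ≡ F m x
  agree zero x = sym (F0 x)
  agree (suc m) x = trans (cong (λ r → g m r x) (agree m x)) (sym (FS m x))

rec-primRec₂ : ∀ {F : ℕ → ℕ → ℕ → ℕ} {f g} → (∀ x y → F 0 x y ≡ f x y) →
               (∀ m x y → F (suc m) x y ≡ g m (F m x y) x y) →
               Recursive₂ f → Recursive₄ g → Recursive₃ F
rec-primRec₂ {F} {f} {g} F0 FS (rec₂ f⇓) (rec₄ g⇓) =
  rec₃ (Recursive-ext (λ { (m ∷ x ∷ y ∷ []) → agree m x y }) (rec-primRecVec f⇓ g⇓))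
  where
  agree : ∀ m x y → primRecVec (λ xs → f (lookup xs fz) (lookup xs (fs fz)))
                      (λ xs → g (lookup xs fz) (lookup xs (fs fz)) (lookup xs (fs (fs fz)))
                                (lookup xs (fs (fs (fs fz)))))
                      m (x ∷ y ∷ []) ≡ F m x y
  agree zero x y = sym (F0 x y)
  agree (suc m) x y = trans (cong (λ r → g m r x y) (agree m x y)) (sym (FS m x y))

rec-pred : Recursive₁ pred
rec-pred = rec-primRec₀ {g = λ m _ → m} refl (λ _ → refl) (rec₂ var₀)

rec-∸ : Recursive₂ _∸_
rec-∸ = rec₂ (ap₂ flipped var₁ var₀)
  where
  flipped : Recursive₂ (λ y x → x ∸ y)
  flipped = rec-primRec₁ {g = λ _ r _ → pred r} (λ _ → refl)
              (λ y x → sym (pred[m∸n]≡m∸[1+n] x y)) (rec₁ var₀) (rec₃ (ap₁ rec-pred var₁))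

rec-+ : Recursive₂ _+_
rec-+ = rec-primRec₁ {g = λ _ r _ → suc r} (λ _ → refl) (λ _ _ → refl) (rec₁ var₀)
          (rec₃ (ap₁ rec-suc var₁))

ifz : ℕ → ℕ → ℕ → ℕ
ifz zero a b = a
ifz (suc _) a b = b

ifz-≢0 : ∀ {x a b} → x ≢ 0 → ifz x a b ≡ b
ifz-≢0 {zero} x≢0 = ⊥-elim (x≢0 refl)
ifz-≢0 {suc _} _ = refl

rec-ifz : Recursive₃ ifz
rec-ifz = rec-primRec₂ {g = λ _ _ _ b → b} (λ _ _ → refl) (λ _ _ _ → refl) (rec₂ var₀) (rec₄ var₃)

rec-∣-∣ : Recursive₂ ∣_-_∣
rec-∣-∣ = Recursive₂-ext ∸+∸≡∣-∣ (rec₂ (ap₂ rec-+ (ap₂ rec-∸ var₀ var₁) (ap₂ rec-∸ var₁ var₀)))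
  where
  Recursive₂-ext : ∀ {F G} → (∀ x y → F x y ≡ G x y) → Recursive₂ F → Recursive₂ G
  Recursive₂-ext F≗G (rec₂ F⇓) = rec₂ (Recursive-ext (λ { (x ∷ y ∷ []) → F≗G x y }) F⇓)
  ∸+∸≡∣-∣ : ∀ a b → (a ∸ b) + (b ∸ a) ≡ ∣ a - b ∣
  ∸+∸≡∣-∣ zero zero = refl
  ∸+∸≡∣-∣ zero (suc b) = refl
  ∸+∸≡∣-∣ (suc a) zero = +-identityʳ (suc a)
  ∸+∸≡∣-∣ (suc a) (suc b) = ∸+∸≡∣-∣ a b

rec-tri : Recursive₁ tri
rec-tri = rec-primRec₀ {g = λ m r → suc m + r} refl (λ _ → refl)
            (rec₂ (ap₂ rec-+ (ap₁ rec-suc var₀) var₁))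

rec-pair : Recursive₂ pair
rec-pair = rec₂ (ap₂ rec-+ (ap₁ rec-tri (ap₂ rec-+ var₀ var₁)) var₁)

countBelow : (ℕ → ℕ → ℕ) → ℕ → ℕ → ℕ
countBelow f zero x = 0
countBelow f (suc m) x = countBelow f m x + f m x

rec-countBelow : ∀ {f} → Recursive₂ f → Recursive₂ (countBelow f)
rec-countBelow {f} f⇓ = rec-primRec₁ {g = λ m r x → r + f m x} (λ _ → refl) (λ _ _ → refl)
                          (rec₁ (const 0)) (rec₃ (ap₂ rec-+ var₁ (ap₂ f⇓ var₀ var₂)))

countBelow-threshold : ∀ {f x} s → (∀ j → j < s → f j x ≡ 1) → (∀ j → s ≤ j → f j x ≡ 0) →
                       ∀ m → countBelow f m x ≡ m ⊓ s
countBelow-threshold s below above zero = refl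
countBelow-threshold {f} {x} s below above (suc m) with m <? s
... | yes m<s = begin
  countBelow f m x + f m x  ≡⟨ cong₂ _+_ (countBelow-threshold s below above m) (below m m<s) ⟩
  m ⊓ s + 1                 ≡⟨ cong (_+ 1) (m≤n⇒m⊓n≡m (<⇒≤ m<s)) ⟩
  m + 1                     ≡⟨ +-comm m 1 ⟩
  suc m                     ≡⟨ sym (m≤n⇒m⊓n≡m m<s) ⟩
  suc m ⊓ s                 ∎
  where open ≡-Reasoning
... | no m≮s = begin
  countBelow f m x + f m x  ≡⟨ cong₂ _+_ (countBelow-threshold s below above m) (above m (≮⇒≥ m≮s)) ⟩
  m ⊓ s + 0                 ≡⟨ +-identityʳ (m ⊓ s) ⟩
  m ⊓ s                     ≡⟨ m≥n⇒m⊓n≡n (≮⇒≥ m≮s) ⟩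
  s                         ≡⟨ sym (m≥n⇒m⊓n≡n (m≤n⇒m≤1+n (≮⇒≥ m≮s))) ⟩
  suc m ⊓ s                 ∎
  where open ≡-Reasoning

leq : ℕ → ℕ → ℕ
leq a b = ifz (a ∸ b) 1 0

rec-leq : Recursive₂ leq
rec-leq = rec₂ (ap₃ rec-ifz (ap₂ rec-∸ var₀ var₁) (const 1) (const 0))

leq-≤ : ∀ {a b} → a ≤ b → leq a b ≡ 1
leq-≤ a≤b = cong (λ d → ifz d 1 0) (m≤n⇒m∸n≡0 a≤b)

leq-> : ∀ {a b} → b < a → leq a b ≡ 0
leq-> b<a = ifz-≢0 (m>n⇒m∸n≢0 b<a)

tri-mono : ∀ {j k} → j ≤ k → tri j ≤ tri k
tri-mono {zero} _ = z≤n
tri-mono {suc j} {suc k} (s≤s j≤k) = +-mono-≤ (s≤s j≤k) (tri-mono j≤k)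

n≤tri : ∀ n → n ≤ tri n
n≤tri zero = z≤n
n≤tri (suc n) = m≤m+n (suc n) (tri n)

pair<tri : ∀ a b {j} → a + b ≤ j → pair a b < tri (suc j)
pair<tri a b {j} a+b≤j = begin-strict
  tri (a + b) + b        ≤⟨ +-monoʳ-≤ (tri (a + b)) (m≤n+m b a) ⟩
  tri (a + b) + (a + b)  ≡⟨ +-comm (tri (a + b)) (a + b) ⟩
  (a + b) + tri (a + b)  <⟨ n<1+n _ ⟩
  tri (suc (a + b))      ≤⟨ tri-mono (s≤s a+b≤j) ⟩
  tri (suc j)            ∎
  where open ≤-Reasoning

diagonal : ℕ → ℕ
diagonal z = countBelow (λ j z → leq (tri (suc j)) z) z z

unpair₁ unpair₂ : ℕ → ℕ
unpair₂ z = z ∸ tri (diagonal z)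
unpair₁ z = diagonal z ∸ unpair₂ z

rec-diagonal : Recursive₁ diagonal
rec-diagonal = rec₁ (ap₂ (rec-countBelow (rec₂ (ap₂ rec-leq (ap₁ rec-tri (ap₁ rec-suc var₀)) var₁)))
                         var₀ var₀)

rec-unpair₂ : Recursive₁ unpair₂
rec-unpair₂ = rec₁ (ap₂ rec-∸ var₀ (ap₁ rec-tri (ap₁ rec-diagonal var₀)))

rec-unpair₁ : Recursive₁ unpair₁
rec-unpair₁ = rec₁ (ap₂ rec-∸ (ap₁ rec-diagonal var₀) (ap₁ rec-unpair₂ var₀))

diagonal-pair : ∀ a b → diagonal (pair a b) ≡ a + b
diagonal-pair a b =
  trans (countBelow-threshold (a + b) below above (pair a b)) (m≥n⇒m⊓n≡n a+b≤pair)
  where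
  below : ∀ j → j < a + b → leq (tri (suc j)) (pair a b) ≡ 1
  below j j<a+b = leq-≤ (≤-trans (tri-mono j<a+b) (m≤m+n (tri (a + b)) b))
  above : ∀ j → a + b ≤ j → leq (tri (suc j)) (pair a b) ≡ 0
  above j a+b≤j = leq-> (pair<tri a b a+b≤j)
  a+b≤pair : a + b ≤ pair a b
  a+b≤pair = ≤-trans (n≤tri (a + b)) (m≤m+n (tri (a + b)) b)

unpair₂-pair : ∀ a b → unpair₂ (pair a b) ≡ b
unpair₂-pair a b rewrite diagonal-pair a b = m+n∸m≡n (tri (a + b)) b

unpair₁-pair : ∀ a b → unpair₁ (pair a b) ≡ a
unpair₁-pair a b rewrite diagonal-pair a b | m+n∸m≡n (tri (a + b)) b = m+n∸n≡m a b

prefixCode : Baire → ℕ → ℕ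
prefixCode p K = codeList (prefix K p)

prefixCode-cong : ∀ {p p′} → p ≗ p′ → ∀ K → prefixCode p K ≡ prefixCode p′ K
prefixCode-cong p≗p′ zero = refl
prefixCode-cong p≗p′ (suc K) = cong₂ (λ x c → suc (pair x c)) (p≗p′ K) (prefixCode-cong p≗p′ K)

consCode : ℕ → ℕ → ℕ
consCode x c = suc (pair x c)

headCode tailCode : ℕ → ℕ
headCode c = unpair₁ (c ∸ 1)
tailCode c = unpair₂ (c ∸ 1)

rec-consCode : Recursive₂ consCode
rec-consCode = rec₂ (ap₁ rec-suc (ap₂ rec-pair var₀ var₁))

rec-headCode : Recursive₁ headCode
rec-headCode = rec₁ (ap₁ rec-unpair₁ (ap₂ rec-∸ var₀ (const 1)))

rec-tailCode : Recursive₁ tailCode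
rec-tailCode = rec₁ (ap₁ rec-unpair₂ (ap₂ rec-∸ var₀ (const 1)))

tailCode-prefixCode : ∀ p K → tailCode (prefixCode p K) ≡ prefixCode p (pred K)
tailCode-prefixCode p zero = refl
tailCode-prefixCode p (suc K) = unpair₂-pair (p K) (prefixCode p K)

dropCode : ℕ → ℕ → ℕ
dropCode zero c = c
dropCode (suc j) c = tailCode (dropCode j c)

rec-dropCode : Recursive₂ dropCode
rec-dropCode = rec-primRec₁ {g = λ _ r _ → tailCode r} (λ _ → refl) (λ _ _ → refl) (rec₁ var₀)
                 (rec₃ (ap₁ rec-tailCode var₁))

dropCode-prefixCode : ∀ p K j → dropCode j (prefixCode p K) ≡ prefixCode p (K ∸ j)
dropCode-prefixCode p K zero = refl
dropCode-prefixCode p K (suc j) = begin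
  tailCode (dropCode j (prefixCode p K))  ≡⟨ cong tailCode (dropCode-prefixCode p K j) ⟩
  tailCode (prefixCode p (K ∸ j))         ≡⟨ tailCode-prefixCode p (K ∸ j) ⟩
  prefixCode p (pred (K ∸ j))             ≡⟨ cong (prefixCode p) (pred[m∸n]≡m∸[1+n] K j) ⟩
  prefixCode p (K ∸ suc j)                ∎
  where open ≡-Reasoning

lengthCode : ℕ → ℕ
lengthCode c = countBelow (λ j c → ifz (dropCode j c) 0 1) c c

rec-lengthCode : Recursive₁ lengthCode
rec-lengthCode =
  rec₁ (ap₂ (rec-countBelow (rec₂ (ap₃ rec-ifz (ap₂ rec-dropCode var₀ var₁) (const 0) (const 1))))
            var₀ var₀)

K≤prefixCode : ∀ p K → K ≤ prefixCode p K
K≤prefixCode p zero = z≤n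
K≤prefixCode p (suc K) = s≤s (≤-trans (K≤prefixCode p K) (m≤n+m _ (tri (p K + prefixCode p K))))

lengthCode-prefixCode : ∀ p K → lengthCode (prefixCode p K) ≡ K
lengthCode-prefixCode p K =
  trans (countBelow-threshold K below above (prefixCode p K)) (m≥n⇒m⊓n≡n (K≤prefixCode p K))
  where
  nonempty : ∀ n → 0 < n → ifz (prefixCode p n) 0 1 ≡ 1
  nonempty (suc n) _ = refl
  below : ∀ j → j < K → ifz (dropCode j (prefixCode p K)) 0 1 ≡ 1
  below j j<K rewrite dropCode-prefixCode p K j = nonempty (K ∸ j) (m<n⇒0<n∸m j<K)
  above : ∀ j → K ≤ j → ifz (dropCode j (prefixCode p K)) 0 1 ≡ 0
  above j K≤j rewrite dropCode-prefixCode p K j | m≤n⇒m∸n≡0 K≤j = refl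

-- reads entry i from a prefix code: suc (entry), or 0 if the prefix is too short
readInput : ℕ → ℕ → ℕ
readInput i c = ifz (leq (suc i) (lengthCode c)) 0 (suc (headCode (dropCode (lengthCode c ∸ suc i) c)))

rec-readInput : Recursive₂ readInput
rec-readInput = rec₂ (ap₃ rec-ifz (ap₂ rec-leq (ap₁ rec-suc var₀) (ap₁ rec-lengthCode var₁)) (const 0)
                  (ap₁ rec-suc (ap₁ rec-headCode
                    (ap₂ rec-dropCode (ap₂ rec-∸ (ap₁ rec-lengthCode var₁) (ap₁ rec-suc var₀)) var₁))))

readInput-< : ∀ p K i → i < K → readInput i (prefixCode p K) ≡ suc (p i)
readInput-< p K i i<K rewrite lengthCode-prefixCode p K | leq-≤ i<K
                             | dropCode-prefixCode p K (K ∸ suc i) | m∸[m∸n]≡n i<K =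
  cong suc (unpair₁-pair (p i) (prefixCode p i))

readInput-≥ : ∀ p K i → K ≤ i → readInput i (prefixCode p K) ≡ 0
readInput-≥ p K i K≤i rewrite lengthCode-prefixCode p K | leq-> (s≤s K≤i) = refl

firstNonZero : (ℕ → ℕ) → ℕ → ℕ
firstNonZero t zero = 0
firstNonZero t (suc m) = ifz (firstNonZero t m) (t m) (firstNonZero t m)

rec-firstNonZero : ∀ {t : ℕ → ℕ → ℕ → ℕ} → Recursive₃ t →
                   Recursive₃ (λ m x y → firstNonZero (λ j → t j x y) m)
rec-firstNonZero {t} t⇓ =
  rec-primRec₂ {g = λ m r x y → ifz r (t m x y) r} (λ _ _ → refl) (λ _ _ _ → refl)
    (rec₂ (const 0)) (rec₄ (ap₃ rec-ifz var₁ (ap₃ t⇓ var₀ var₂ var₃) var₁))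

firstNonZero-zero : ∀ t m → (∀ j → j < m → t j ≡ 0) → firstNonZero t m ≡ 0
firstNonZero-zero t zero _ = refl
firstNonZero-zero t (suc m) zeros
  rewrite firstNonZero-zero t m (λ j j<m → zeros j (m<n⇒m<1+n j<m)) = zeros m ≤-refl

firstNonZero-zero⁻¹ : ∀ t m → firstNonZero t m ≡ 0 → ∀ j → j < m → t j ≡ 0
firstNonZero-zero⁻¹ t (suc m) e j j<1+m with firstNonZero t m in e′
... | suc _ = ⊥-elim (1+n≢0 e)
... | zero with j ≟ m
...   | yes refl = e
...   | no j≢m = firstNonZero-zero⁻¹ t m e′ j (≤∧≢⇒< (s≤s⁻¹ j<1+m) j≢m)

firstNonZero-found : ∀ t m k w → (∀ j → j < k → t j ≡ 0) → t k ≡ suc w → k < m →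
                     firstNonZero t m ≡ suc w
firstNonZero-found t (suc m) k w zeros tk k<1+m with k ≟ m
... | yes refl rewrite firstNonZero-zero t k zeros = tk
... | no k≢m rewrite firstNonZero-found t m k w zeros tk (≤∧≢⇒< (s≤s⁻¹ k<1+m) k≢m) = refl

firstNonZero-sound : ∀ t m w → firstNonZero t m ≡ suc w →
                     Σ[ k ∈ ℕ ] (k < m × (∀ j → j < k → t j ≡ 0) × t k ≡ suc w)
firstNonZero-sound t (suc m) w e with firstNonZero t m in e′
... | zero = m , ≤-refl , firstNonZero-zero⁻¹ t m e′ , e
... | suc _ with firstNonZero-sound t m w (trans e′ e)
...   | k , k<m , zeros , tk = k , m<n⇒m<1+n k<m , zeros , tk

firstNonZero-nonZero : ∀ t m j w → t j ≡ suc w → j < m → Σ[ v ∈ ℕ ] firstNonZero t m ≡ suc v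
firstNonZero-nonZero t (suc m) j w tj j<1+m with firstNonZero t m in e′
... | suc v = v , refl
... | zero with j ≟ m
...   | yes refl = w , tj
...   | no j≢m = ⊥-elim (1+n≢0 (trans (sym tj)
                   (firstNonZero-zero⁻¹ t m e′ j (≤∧≢⇒< (s≤s⁻¹ j<1+m) j≢m))))

leastNonZero : ∀ t {j w} → t j ≡ suc w → Σ[ k ∈ ℕ ] Σ[ v ∈ ℕ ] ((∀ i → i < k → t i ≡ 0) × t k ≡ suc v)
leastNonZero t {j} {w} tj =
  let (v , found) = firstNonZero-nonZero t (suc j) j w tj ≤-refl
      (k , _ , zeros , tk) = firstNonZero-sound t (suc j) v found
  in k , v , zeros , tk

Eventually : (ℕ → Set) → Set
Eventually P = Σ[ K₀ ∈ ℕ ] (∀ K → K₀ ≤ K → P K)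

eventually-map : ∀ {P Q : ℕ → Set} → (∀ {K} → P K → Q K) → Eventually P → Eventually Q
eventually-map P⇒Q (K₀ , ev) = K₀ , λ K K₀≤K → P⇒Q (ev K K₀≤K)

eventually-≥ : ∀ k → Eventually (k ≤_)
eventually-≥ k = k , λ _ k≤K → k≤K

eventually-× : ∀ {P Q : ℕ → Set} → Eventually P → Eventually Q → Eventually (λ K → P K × Q K)
eventually-× (K₁ , evP) (K₂ , evQ) =
  K₁ ⊔ K₂ , λ K ≤K → evP K (≤-trans (m≤m⊔n K₁ K₂) ≤K) , evQ K (≤-trans (m≤n⊔m K₁ K₂) ≤K)

eventually-∀< : ∀ {P : ℕ → ℕ → Set} m → (∀ i → i < m → Eventually (P i)) →
                Eventually (λ K → ∀ i → i < m → P i K)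
eventually-∀< zero _ = 0 , λ _ _ _ ()
eventually-∀< {P} (suc m) ev =
  eventually-map extend (eventually-× (eventually-∀< m (λ i i<m → ev i (m<n⇒m<1+n i<m))) (ev m ≤-refl))
  where
  extend : ∀ {K} → (∀ i → i < m → P i K) × P m K → ∀ i → i < suc m → P i K
  extend (below , atm) i i<1+m with i ≟ m
  ... | yes refl = atm
  ... | no i≢m = below i (≤∧≢⇒< (s≤s⁻¹ i<1+m) i≢m)

-- h i c = suc v: after reading the prefix coded by c, output entry i is v; h i c = 0: not yet known.
Sound : (ℕ → ℕ → ℕ) → Baire → Baire → Set
Sound h p q = ∀ i K v → h i (prefixCode p K) ≡ suc v → q i ≡ v

Complete : (ℕ → ℕ → ℕ) → Baire → Set
Complete h p = ∀ i → Eventually (λ K → Σ[ v ∈ ℕ ] h i (prefixCode p K) ≡ suc v)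

record Approx (h : ℕ → ℕ → ℕ) (p q : Baire) : Set where
  constructor approx
  field
    sound : Sound h p q
    complete : Complete h p

approx-eventually : ∀ {h p q} → Approx h p q → ∀ i → Eventually (λ K → h i (prefixCode p K) ≡ suc (q i))
approx-eventually {h} {p} {q} (approx sound complete) i = eventually-map correct (complete i)
  where
  correct : ∀ {K} → Σ[ v ∈ ℕ ] h i (prefixCode p K) ≡ suc v → h i (prefixCode p K) ≡ suc (q i)
  correct {K} (v , hv) = trans hv (cong suc (sym (sound i K v hv)))

Assoc-unique : ∀ {γ q r} → Assoc γ q r → ∀ n k v → γ (pair n (prefixCode q k)) ≡ suc v →
               (∀ j → j < k → γ (pair n (prefixCode q j)) ≡ 0) → v ≡ r n
Assoc-unique assoc n k v γk silent with assoc n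
... | k₀ , γk₀ , silent₀ with <-cmp k k₀
... | tri< k<k₀ _ _ = ⊥-elim (1+n≢0 (trans (sym γk) (silent₀ k k<k₀)))
... | tri> _ _ k₀<k = ⊥-elim (1+n≢0 (trans (sym γk₀) (silent k₀ k₀<k)))
... | tri≈ _ refl _ = suc-injective (trans (sym γk) γk₀)

constApprox : Baire → ℕ → ℕ → ℕ
constApprox γ i _ = suc (γ i)

rec-constApprox : ∀ {γ} → Recursive₁ γ → Recursive₂ (constApprox γ)
rec-constApprox γ⇓ = rec₂ (ap₁ rec-suc (ap₁ γ⇓ var₀))

approx-const : ∀ γ p → Approx (constApprox γ) p γ
approx-const γ p = approx (λ _ _ _ → suc-injective) λ i → 0 , λ _ _ → γ i , refl

approx-readInput : ∀ p → Approx readInput p p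
approx-readInput p = approx sound λ i → suc i , λ K i<K → p i , readInput-< p K i i<K
  where
  sound : Sound readInput p p
  sound i K v e with i <? K
  ... | yes i<K = suc-injective (trans (sym (readInput-< p K i i<K)) e)
  ... | no i≮K = ⊥-elim (0≢1+n (trans (sym (readInput-≥ p K i (≮⇒≥ i≮K))) e))

-- suc (code of the first k outputs of h on c), or 0 while one of them is missing
approxPrefix : (ℕ → ℕ → ℕ) → ℕ → ℕ → ℕ
approxPrefix h zero c = 1
approxPrefix h (suc k) c =
  ifz (approxPrefix h k c) 0 (ifz (h k c) 0 (suc (consCode (h k c ∸ 1) (approxPrefix h k c ∸ 1))))

rec-approxPrefix : ∀ {h} → Recursive₂ h → Recursive₂ (approxPrefix h)
rec-approxPrefix {h} h⇓ =
  rec-primRec₁ {g = λ k r c → ifz r 0 (ifz (h k c) 0 (suc (consCode (h k c ∸ 1) (r ∸ 1))))}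
    (λ _ → refl) (λ _ _ → refl) (rec₁ (const 1))
    (rec₃ (ap₃ rec-ifz var₁ (const 0)
            (ap₃ rec-ifz (ap₂ h⇓ var₀ var₂) (const 0)
              (ap₁ rec-suc (ap₂ rec-consCode (ap₂ rec-∸ (ap₂ h⇓ var₀ var₂) (const 1))
                                             (ap₂ rec-∸ var₁ (const 1)))))))

approxPrefix-complete : ∀ h q c k → (∀ i → i < k → h i c ≡ suc (q i)) →
                        approxPrefix h k c ≡ suc (prefixCode q k)
approxPrefix-complete h q c zero _ = refl
approxPrefix-complete h q c (suc k) known
  rewrite approxPrefix-complete h q c k (λ i i<k → known i (m<n⇒m<1+n i<k)) | known k ≤-refl = refl

approxPrefix-sound : ∀ h q c k b → (∀ i v → h i c ≡ suc v → q i ≡ v) →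
                     approxPrefix h k c ≡ suc b → b ≡ prefixCode q k
approxPrefix-sound h q c zero b _ e = sym (suc-injective e)
approxPrefix-sound h q c (suc k) b sound e with approxPrefix h k c in ek | h k c in ehk
... | zero | _ = ⊥-elim (0≢1+n e)
... | suc _ | zero = ⊥-elim (0≢1+n e)
... | suc b′ | suc v rewrite sound k v ehk | approxPrefix-sound h q c k b′ sound ek = sym (suc-injective e)

prefixApprox : (ℕ → ℕ) → (ℕ → ℕ → ℕ) → ℕ → ℕ → ℕ
prefixApprox ℓ Φ m c = ifz (approxPrefix readInput (ℓ m) c) 0 (suc (Φ m (approxPrefix readInput (ℓ m) c ∸ 1)))

rec-prefixApprox : ∀ {ℓ Φ} → Recursive₁ ℓ → Recursive₂ Φ → Recursive₂ (prefixApprox ℓ Φ)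
rec-prefixApprox {ℓ} ℓ⇓ Φ⇓ =
  rec₂ (ap₃ rec-ifz readPrefix (const 0) (ap₁ rec-suc (ap₂ Φ⇓ var₀ (ap₂ rec-∸ readPrefix (const 1)))))
  where
  readPrefix : Recursive {2} (λ xs → approxPrefix readInput (ℓ (lookup xs fz)) (lookup xs (fs fz)))
  readPrefix = ap₂ (rec-approxPrefix rec-readInput) (ap₁ ℓ⇓ var₀) var₁

approx-prefixApprox : ∀ ℓ Φ p → Approx (prefixApprox ℓ Φ) p (λ m → Φ m (prefixCode p (ℓ m)))
approx-prefixApprox ℓ Φ p = approx sound complete
  where
  sound : Sound (prefixApprox ℓ Φ) p (λ m → Φ m (prefixCode p (ℓ m)))
  sound m K v e with approxPrefix readInput (ℓ m) (prefixCode p K) in eb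
  ... | zero = ⊥-elim (0≢1+n e)
  ... | suc b with approxPrefix-sound readInput p (prefixCode p K) (ℓ m) b
                     (λ i → Approx.sound (approx-readInput p) i K) eb
  ...   | refl = suc-injective e
  complete : Complete (prefixApprox ℓ Φ) p
  complete m = eventually-map read (eventually-≥ (ℓ m))
    where
    read : ∀ {K} → ℓ m ≤ K → Σ[ v ∈ ℕ ] prefixApprox ℓ Φ m (prefixCode p K) ≡ suc v
    read {K} ℓm≤K rewrite approxPrefix-complete readInput p (prefixCode p K) (ℓ m)
                            (λ i i<ℓm → readInput-< p K i (<-≤-trans i<ℓm ℓm≤K)) = _ , refl

-- Turns an approximated associate value (0: unknown, suc w: value w) into the form searched for by
-- firstNonZero: 1 = unknown, 0 = the associate is silent (w = 0), suc (suc v) = it answers v.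
recode : ℕ → ℕ
recode a = ifz a 1 (ifz (a ∸ 1) 0 a)

recoded : ℕ → ℕ
recoded w = recode (suc w)

recoded≡0 : ∀ {w} → recoded w ≡ 0 → w ≡ 0
recoded≡0 {zero} _ = refl

recoded≡2+ : ∀ {w v} → recoded w ≡ suc (suc v) → w ≡ suc v
recoded≡2+ {suc w} e = suc-injective e

applyStep : (ℕ → ℕ → ℕ) → (ℕ → ℕ → ℕ) → ℕ → ℕ → ℕ → ℕ
applyStep hγ hq n c k = ifz (approxPrefix hq k c) 1 (recode (hγ (pair n (approxPrefix hq k c ∸ 1)) c))

apply : (ℕ → ℕ → ℕ) → (ℕ → ℕ → ℕ) → ℕ → ℕ → ℕ
apply hγ hq n c = firstNonZero (applyStep hγ hq n c) (suc (lengthCode c)) ∸ 1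

rec-apply : ∀ {hγ hq} → Recursive₂ hγ → Recursive₂ hq → Recursive₂ (apply hγ hq)
rec-apply {hγ} {hq} γ⇓ q⇓ =
  rec₂ (ap₂ rec-∸ (ap₃ (rec-firstNonZero {λ k n c → applyStep hγ hq n c k} step⇓)
                         (ap₁ rec-suc (ap₁ rec-lengthCode var₁)) var₀ var₁)
                  (const 1))
  where
  rec-recode : Recursive₁ recode
  rec-recode = rec₁ (ap₃ rec-ifz var₀ (const 1) (ap₃ rec-ifz (ap₂ rec-∸ var₀ (const 1)) (const 0) var₀))
  prefix⇓ : Recursive {3} (λ xs → approxPrefix hq (lookup xs fz) (lookup xs (fs (fs fz))))
  prefix⇓ = ap₂ (rec-approxPrefix q⇓) var₀ var₂
  step⇓ : Recursive₃ (λ k n c → applyStep hγ hq n c k)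
  step⇓ = rec₃ (ap₃ rec-ifz prefix⇓ (const 1)
                  (ap₁ rec-recode (ap₂ γ⇓ (ap₂ rec-pair var₁ (ap₂ rec-∸ prefix⇓ (const 1))) var₂)))

applyStep-≢1 : ∀ hγ hq n c k → applyStep hγ hq n c k ≢ 1 →
               Σ[ b ∈ ℕ ] Σ[ w ∈ ℕ ] (approxPrefix hq k c ≡ suc b × hγ (pair n b) c ≡ suc w ×
                                     applyStep hγ hq n c k ≡ recoded w)
applyStep-≢1 hγ hq n c k ≢1 with approxPrefix hq k c
... | zero = ⊥-elim (≢1 refl)
... | suc b = let (w , answer , step) = recode-≢1 (hγ (pair n b) c) ≢1 in b , w , refl , answer , step
  where
  recode-≢1 : ∀ a → recode a ≢ 1 → Σ[ w ∈ ℕ ] (a ≡ suc w × recode a ≡ recoded w)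
  recode-≢1 zero ≢1 = ⊥-elim (≢1 refl)
  recode-≢1 (suc w) _ = w , refl , refl

∸1≡suc : ∀ {x v} → x ∸ 1 ≡ suc v → x ≡ suc (suc v)
∸1≡suc {suc (suc x)} e = cong suc e

module _ {hγ hq : ℕ → ℕ → ℕ} {p γ q r : Baire}
         (approxγ : Approx hγ p γ) (approxq : Approx hq p q) (assocγ : Assoc γ q r) where

  private
    applyStep-prefix : ∀ n c k w → approxPrefix hq k c ≡ suc (prefixCode q k) →
                       hγ (pair n (prefixCode q k)) c ≡ suc w → applyStep hγ hq n c k ≡ recoded w
    applyStep-prefix n c k w prefix answer = begin
      applyStep hγ hq n c k
        ≡⟨ cong (λ b → ifz b 1 (recode (hγ (pair n (b ∸ 1)) c))) prefix ⟩
      recode (hγ (pair n (prefixCode q k)) c)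
        ≡⟨ cong recode answer ⟩
      recoded w ∎
      where open ≡-Reasoning

    applyStep-reads : ∀ n K k → applyStep hγ hq n (prefixCode p K) k ≢ 1 →
                      applyStep hγ hq n (prefixCode p K) k ≡ recoded (γ (pair n (prefixCode q k)))
    applyStep-reads n K k ≢1 with applyStep-≢1 hγ hq n (prefixCode p K) k ≢1
    ... | b , w , eb , ew , e with approxPrefix-sound hq q _ k b (λ i → Approx.sound approxq i K) eb
    ...   | refl = trans e (cong recoded (sym (Approx.sound approxγ _ K w ew)))

  apply-sound : Sound (apply hγ hq) p r
  apply-sound n K v e
    with firstNonZero-sound (applyStep hγ hq n (prefixCode p K)) (suc (lengthCode (prefixCode p K)))
                             (suc v) (∸1≡suc e)
  ... | k , _ , zeros , answer =
    sym (Assoc-unique {γ} {q} {r} assocγ n k v (recoded≡2+ (trans (sym (reads k answer λ ())) answer))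
                      (λ j j<k → recoded≡0 (trans (sym (reads j (zeros j j<k) λ ())) (zeros j j<k))))
    where
    reads : ∀ j {x} → applyStep hγ hq n (prefixCode p K) j ≡ x → x ≢ 1 →
            applyStep hγ hq n (prefixCode p K) j ≡ recoded (γ (pair n (prefixCode q j)))
    reads j e x≢1 = applyStep-reads n K j (λ e₁ → x≢1 (trans (sym e) e₁))

  apply-complete : Complete (apply hγ hq) p
  apply-complete n with assocγ n
  ... | k₀ , answer , silent =
    eventually-map output
      (eventually-× (eventually-≥ k₀)
        (eventually-× (eventually-∀< k₀ (λ i _ → approx-eventually approxq i))
                      (eventually-∀< (suc k₀) (λ j _ → approx-eventually approxγ (query j)))))
    where
    query : ℕ → ℕ
    query j = pair n (prefixCode q j)
    output : ∀ {K} → k₀ ≤ K × (∀ i → i < k₀ → hq i (prefixCode p K) ≡ suc (q i)) ×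
                     (∀ j → j < suc k₀ → hγ (query j) (prefixCode p K) ≡ suc (γ (query j))) →
             Σ[ v ∈ ℕ ] apply hγ hq n (prefixCode p K) ≡ suc v
    output {K} (k₀≤K , qKnown , γKnown) =
      r n , cong (_∸ 1) (firstNonZero-found _ _ k₀ _ silentSteps answerStep
                          (s≤s (subst (k₀ ≤_) (sym (lengthCode-prefixCode p K)) k₀≤K)))
      where
      step : ∀ j → j ≤ k₀ → applyStep hγ hq n (prefixCode p K) j ≡ recoded (γ (query j))
      step j j≤k₀ = applyStep-prefix n _ j _
                      (approxPrefix-complete hq q _ j (λ i i<j → qKnown i (<-≤-trans i<j j≤k₀)))
                      (γKnown j (s≤s j≤k₀))
      silentSteps : ∀ j → j < k₀ → applyStep hγ hq n (prefixCode p K) j ≡ 0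
      silentSteps j j<k₀ = trans (step j (<⇒≤ j<k₀)) (cong recoded (silent j j<k₀))
      answerStep : applyStep hγ hq n (prefixCode p K) k₀ ≡ suc (suc (r n))
      answerStep = trans (step k₀ ≤-refl) (cong recoded answer)

  apply-approx : Approx (apply hγ hq) p r
  apply-approx = approx apply-sound apply-complete

readEvens readOdds : ℕ → ℕ → ℕ
readEvens i = readInput (2 * i)
readOdds i = readInput (suc (2 * i))

rec-readEvens : Recursive₂ readEvens
rec-readEvens = rec₂ (ap₂ rec-readInput (ap₂ rec-+ var₀ (ap₂ rec-+ var₀ (const 0))) var₁)

rec-readOdds : Recursive₂ readOdds
rec-readOdds = rec₂ (ap₂ rec-readInput (ap₁ rec-suc (ap₂ rec-+ var₀ (ap₂ rec-+ var₀ (const 0)))) var₁)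

approx-evens : ∀ p → Approx readEvens p (evens p)
approx-evens p = approx (λ i → sound (2 * i)) (λ i → complete (2 * i))
  where open Approx (approx-readInput p)

approx-odds : ∀ p → Approx readOdds p (odds p)
approx-odds p = approx (λ i → sound (suc (2 * i))) (λ i → complete (suc (2 * i)))
  where open Approx (approx-readInput p)

parity : ℕ → ℕ
parity zero = 0
parity (suc m) = 1 ∸ parity m

half : ℕ → ℕ
half zero = 0
half (suc m) = half m + parity m

rec-parity : Recursive₁ parity
rec-parity = rec-primRec₀ {g = λ _ r → 1 ∸ r} refl (λ _ → refl) (rec₂ (ap₂ rec-∸ (const 1) var₁))

rec-half : Recursive₁ half
rec-half = rec-primRec₀ {g = λ m r → r + parity m} refl (λ _ → refl)
             (rec₂ (ap₂ rec-+ var₁ (ap₁ rec-parity var₀)))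

parity-half-even : ∀ i → parity (2 * i) ≡ 0 × half (2 * i) ≡ i
parity-half-even zero = refl , refl
parity-half-even (suc i) rewrite +-suc i (i + 0) | proj₁ (parity-half-even i) | proj₂ (parity-half-even i) =
  refl , trans (cong (_+ 1) (+-identityʳ i)) (+-comm i 1)

parity-half-odd : ∀ i → parity (suc (2 * i)) ≡ 1 × half (suc (2 * i)) ≡ i
parity-half-odd i rewrite proj₁ (parity-half-even i) | proj₂ (parity-half-even i) = refl , +-identityʳ i

half+half+parity : ∀ i → half i + half i + parity i ≡ i × parity i ≤ 1
half+half+parity zero = refl , z≤n
half+half+parity (suc i) with parity i | half+half+parity i
... | zero | e , _ = trans (even-step (half i)) (cong suc e) , ≤-refl
  where
  even-step : ∀ h → (h + 0) + (h + 0) + 1 ≡ suc (h + h + 0)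
  even-step = solve-∀
... | suc zero | e , _ = trans (odd-step (half i)) (cong suc e) , z≤n
  where
  odd-step : ∀ h → (h + 1) + (h + 1) + 0 ≡ suc (h + h + 1)
  odd-step = solve-∀
... | suc (suc _) | _ , s≤s ()

half-< : ∀ i n → i < n + n → half i < n
half-< i n i<n+n with half i <? n
... | yes h<n = h<n
... | no h≮n = ⊥-elim (<⇒≱ i<n+n (begin
  n + n                    ≤⟨ +-mono-≤ (≮⇒≥ h≮n) (≮⇒≥ h≮n) ⟩
  half i + half i          ≤⟨ m≤m+n _ (parity i) ⟩
  half i + half i + parity i ≡⟨ proj₁ (half+half+parity i) ⟩
  i                        ∎))
  where open ≤-Reasoning

interleave : Baire → Baire → Baire
interleave q₁ q₂ m = ifz (parity m) (q₁ (half m)) (q₂ (half m))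

evens-interleave : ∀ q₁ q₂ → evens (interleave q₁ q₂) ≗ q₁
evens-interleave q₁ q₂ i rewrite proj₁ (parity-half-even i) | proj₂ (parity-half-even i) = refl

odds-interleave : ∀ q₁ q₂ → odds (interleave q₁ q₂) ≗ q₂
odds-interleave q₁ q₂ i rewrite proj₁ (parity-half-odd i) | proj₂ (parity-half-odd i) = refl

interleaveApprox : (ℕ → ℕ → ℕ) → (ℕ → ℕ → ℕ) → ℕ → ℕ → ℕ
interleaveApprox h₁ h₂ m c = ifz (parity m) (h₁ (half m) c) (h₂ (half m) c)

rec-interleaveApprox : ∀ {h₁ h₂} → Recursive₂ h₁ → Recursive₂ h₂ → Recursive₂ (interleaveApprox h₁ h₂)
rec-interleaveApprox h₁⇓ h₂⇓ =
  rec₂ (ap₃ rec-ifz (ap₁ rec-parity var₀) (ap₂ h₁⇓ (ap₁ rec-half var₀) var₁) (ap₂ h₂⇓ (ap₁ rec-half var₀) var₁))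

approx-interleave : ∀ {h₁ h₂ p q₁ q₂} → Approx h₁ p q₁ → Approx h₂ p q₂ →
                    Approx (interleaveApprox h₁ h₂) p (interleave q₁ q₂)
approx-interleave {h₁} {h₂} {p} {q₁} {q₂} (approx sound₁ complete₁) (approx sound₂ complete₂) =
  approx sound complete
  where
  sound : Sound (interleaveApprox h₁ h₂) p (interleave q₁ q₂)
  sound m with parity m
  ... | zero = sound₁ (half m)
  ... | suc _ = sound₂ (half m)
  complete : Complete (interleaveApprox h₁ h₂) p
  complete m with parity m
  ... | zero = complete₁ (half m)
  ... | suc _ = complete₂ (half m)

-- entry i of interleave t e, read from pair (prefix code of t) (prefix code of e)
readInterleaved : ℕ → ℕ → ℕ
readInterleaved = interleaveApprox (λ j d → readInput j (unpair₁ d)) (λ j d → readInput j (unpair₂ d))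

interleavePrefix : ℕ → ℕ → ℕ → ℕ
interleavePrefix n ct ce = approxPrefix readInterleaved (n + n) (pair ct ce) ∸ 1

rec-interleavePrefix : Recursive₃ interleavePrefix
rec-interleavePrefix =
  rec₃ (ap₂ rec-∸ (ap₂ (rec-approxPrefix readInterleaved⇓) (ap₂ rec-+ var₀ var₀) (ap₂ rec-pair var₁ var₂))
                  (const 1))
  where
  readInterleaved⇓ : Recursive₂ readInterleaved
  readInterleaved⇓ = rec-interleaveApprox {λ j d → readInput j (unpair₁ d)} {λ j d → readInput j (unpair₂ d)}
                       (rec₂ (ap₂ rec-readInput var₀ (ap₁ rec-unpair₁ var₁)))
                       (rec₂ (ap₂ rec-readInput var₀ (ap₁ rec-unpair₂ var₁)))

interleavePrefix-prefixCode : ∀ t e n →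
  interleavePrefix n (prefixCode t n) (prefixCode e n) ≡ prefixCode (interleave t e) (n + n)
interleavePrefix-prefixCode t e n =
  cong (_∸ 1) (approxPrefix-complete readInterleaved (interleave t e) _ (n + n) reads)
  where
  reads : ∀ i → i < n + n → readInterleaved i (pair (prefixCode t n) (prefixCode e n)) ≡ suc (interleave t e i)
  reads i i<n+n with parity i
  ... | zero rewrite unpair₁-pair (prefixCode t n) (prefixCode e n) = readInput-< t n (half i) (half-< i n i<n+n)
  ... | suc _ rewrite unpair₂-pair (prefixCode t n) (prefixCode e n) = readInput-< e n (half i) (half-< i n i<n+n)

toAssociate : (ℕ → ℕ → ℕ) → Baire
toAssociate h m = h (unpair₁ m) (unpair₂ m)

isComputable : ∀ {α} → Recursive₁ α → IsComputable α
isComputable (rec₁ (c , c⇓)) = c , λ n → c⇓ (n ∷ [])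

recursive : ∀ {α} → IsComputable α → Recursive₁ α
recursive (c , c⇓) = rec₁ (c , λ { (n ∷ []) → c⇓ n })

toAssociate-computable : ∀ {h} → Recursive₂ h → IsComputable (toAssociate h)
toAssociate-computable h⇓ = isComputable (rec₁ (ap₂ h⇓ (ap₁ rec-unpair₁ var₀) (ap₁ rec-unpair₂ var₀)))

toAssociate-assoc : ∀ {h p q} → Approx h p q → Assoc (toAssociate h) p q
toAssociate-assoc {h} {p} {q} (approx sound complete) n =
  let (K₀ , defined) = complete n
      (_ , hK₀) = defined K₀ ≤-refl
      (k , v , silent , hk) = leastNonZero (λ K → h n (prefixCode p K)) hK₀
  in k , trans (at k) (trans hk (cong suc (sym (sound n k v hk)))) , λ j j<k → trans (at j) (silent j j<k)
  where
  at : ∀ j → toAssociate h (pair n (prefixCode p j)) ≡ h n (prefixCode p j)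
  at j = cong₂ h (unpair₁-pair n _) (unpair₂-pair n _)

Assoc-resp-≗-associate : ∀ {α α′ p q} → α ≗ α′ → Assoc α p q → Assoc α′ p q
Assoc-resp-≗-associate α≗α′ assoc n =
  let (k , answer , silent) = assoc n
  in k , trans (sym (α≗α′ _)) answer , λ j j<k → trans (sym (α≗α′ _)) (silent j j<k)

Assoc-resp-≗-input : ∀ {α p p′ q} → p ≗ p′ → Assoc α p q → Assoc α p′ q
Assoc-resp-≗-input {α} {p} {p′} p≗p′ assoc n =
  let (k , answer , silent) = assoc n
      same : ∀ j → α (pair n (prefixCode p′ j)) ≡ α (pair n (prefixCode p j))
      same j = cong (λ c → α (pair n c)) (sym (prefixCode-cong p≗p′ j))
  in k , trans (same k) answer , λ j j<k → trans (same j) (silent j j<k)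

approx-associate : ∀ {α p q} → Assoc α p q → Approx (apply (constApprox α) readInput) p q
approx-associate {α} {p} = apply-approx (approx-const α p) (approx-readInput p)

assoc-∘ : ∀ {α β} → IsComputable α → IsComputable β →
          Σ[ γ ∈ Baire ] (IsComputable γ × (∀ {p q r} → Assoc α p q → Assoc β q r → Assoc γ p r))
assoc-∘ {α} {β} α⇓ β⇓ =
  toAssociate (apply (constApprox β) (apply (constApprox α) readInput)) ,
  toAssociate-computable (rec-apply (rec-constApprox (recursive β⇓))
                            (rec-apply (rec-constApprox (recursive α⇓)) rec-readInput)) ,
  λ {p} pq qr → toAssociate-assoc (apply-approx (approx-const β p) (approx-associate {α} pq) qr)

assoc-evens : Σ[ γ ∈ Baire ] (IsComputable γ × (∀ p → Assoc γ p (evens p)))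
assoc-evens =
  toAssociate readEvens , toAssociate-computable rec-readEvens , λ p → toAssociate-assoc (approx-evens p)

assoc-odds : Σ[ γ ∈ Baire ] (IsComputable γ × (∀ p → Assoc γ p (odds p)))
assoc-odds =
  toAssociate readOdds , toAssociate-computable rec-readOdds , λ p → toAssociate-assoc (approx-odds p)

assoc-interleave : ∀ {α β} → IsComputable α → IsComputable β →
                   Σ[ γ ∈ Baire ] (IsComputable γ ×
                                   (∀ {p q r} → Assoc α p q → Assoc β p r → Assoc γ p (interleave q r)))
assoc-interleave {α} {β} α⇓ β⇓ =
  toAssociate (interleaveApprox (apply (constApprox α) readInput) (apply (constApprox β) readInput)) ,
  toAssociate-computable (rec-interleaveApprox (rec-apply (rec-constApprox (recursive α⇓)) rec-readInput)
                                               (rec-apply (rec-constApprox (recursive β⇓)) rec-readInput)) ,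
  λ pq pr → toAssociate-assoc (approx-interleave (approx-associate {α} pq) (approx-associate {β} pr))

searchBelow : (ℕ → ℕ → ℕ) → ℕ → ℕ → ℕ
searchBelow h n c = firstNonZero (λ j → h j c ∸ 1) n

rec-searchBelow : ∀ {h} → Recursive₂ h → Recursive₂ (searchBelow h)
rec-searchBelow {h} h⇓ =
  rec₂ (ap₃ (rec-firstNonZero {λ j _ c → h j c ∸ 1} (rec₃ (ap₂ rec-∸ (ap₂ h⇓ var₀ var₂) (const 1))))
            var₀ var₁ var₁)

-- n + n: on interleave t e, this prefix contains n entries of each of t and e.
dovetail : (ℕ → ℕ → ℕ) → Baire → Baire
dovetail h w n = searchBelow h n (prefixCode w (n + n))

≢0⇒≡suc : ∀ {x} → x ≢ 0 → Σ[ y ∈ ℕ ] x ≡ suc y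
≢0⇒≡suc {zero} x≢0 = ⊥-elim (x≢0 refl)
≢0⇒≡suc {suc y} _ = y , refl

Sier-dovetail⇒ : ∀ {h w r} → Approx h w r → Sier (dovetail h w) → Sier r
Sier-dovetail⇒ {h} {w} {r} (approx sound _) (n , ≢0) =
  let (x , found) = ≢0⇒≡suc ≢0
      (j , _ , _ , hj) = firstNonZero-sound (λ j → h j (prefixCode w (n + n)) ∸ 1) n x found
  in j , λ rj≡0 → 1+n≢0 (trans (sym (sound j (n + n) (suc x) (∸1≡suc hj))) rj≡0)

Sier-dovetail⇐ : ∀ {h w r} → Approx h w r → Sier r → Sier (dovetail h w)
Sier-dovetail⇐ {h} {w} {r} h≈r (j , rj≢0) =
  let (y , rj≡1+y) = ≢0⇒≡suc rj≢0
      (K₀ , stable) = approx-eventually h≈r j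
      n = suc (j + K₀)
      hj : h j (prefixCode w (n + n)) ∸ 1 ≡ suc y
      hj = trans (cong (_∸ 1) (stable (n + n) (≤-trans (m≤n+m K₀ (suc j)) (m≤m+n n n)))) rj≡1+y
      (_ , found) = firstNonZero-nonZero (λ i → h i (prefixCode w (n + n)) ∸ 1) n j y hj (s≤s (m≤m+n j K₀))
  in n , λ searched≡0 → 1+n≢0 (trans (sym found) searched≡0)

module Transpose (ι : Baire) (ι⇓ : Recursive₁ ι) where

  -- on interleave t e: the output of the function named by ι t at the input e
  evalApprox : ℕ → ℕ → ℕ
  evalApprox = apply (apply (constApprox ι) readEvens) readOdds

  approx-evalApprox : ∀ {t e u r} → Assoc ι t u → Assoc u e r → Approx evalApprox (interleave t e) r
  approx-evalApprox {t} {e} {u} tu ur =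
    apply-approx (apply-approx (approx-const ι (interleave t e)) (approx-evens (interleave t e))
                   (Assoc-resp-≗-input {ι} (λ i → sym (evens-interleave t e i)) tu))
                 (approx-odds (interleave t e))
                 (Assoc-resp-≗-input {u} (λ i → sym (odds-interleave t e i)) ur)

  transposeStep : ℕ → ℕ → ℕ
  transposeStep m ce =
    ifz ∣ lengthCode (unpair₂ m) - unpair₁ m ∣
        (suc (searchBelow evalApprox (unpair₁ m) (interleavePrefix (unpair₁ m) (unpair₂ m) ce))) 0

  -- As an associate, transposeName e answers query n as soon as n input entries have been read.
  transposeName : Baire → Baire
  transposeName e m = transposeStep m (prefixCode e (unpair₁ m))

  transposeName-assoc : ∀ t e → Assoc (transposeName e) t (dovetail evalApprox (interleave t e))
  transposeName-assoc t e n = n , answered , silent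
    where
    answer : ℕ → ℕ
    answer c = suc (searchBelow evalApprox n (interleavePrefix n c (prefixCode e n)))
    at : ∀ c → transposeName e (pair n c) ≡ ifz ∣ lengthCode c - n ∣ (answer c) 0
    at c = cong₂ (λ n′ c′ → ifz ∣ lengthCode c′ - n′ ∣
                              (suc (searchBelow evalApprox n′ (interleavePrefix n′ c′ (prefixCode e n′)))) 0)
                 (unpair₁-pair n c) (unpair₂-pair n c)
    answered : transposeName e (pair n (prefixCode t n)) ≡ suc (dovetail evalApprox (interleave t e) n)
    answered = begin
      transposeName e (pair n (prefixCode t n))
        ≡⟨ at (prefixCode t n) ⟩
      ifz ∣ lengthCode (prefixCode t n) - n ∣ (answer (prefixCode t n)) 0
        ≡⟨ cong (λ L → ifz ∣ L - n ∣ (answer (prefixCode t n)) 0) (lengthCode-prefixCode t n) ⟩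
      ifz ∣ n - n ∣ (answer (prefixCode t n)) 0
        ≡⟨ cong (λ d → ifz d (answer (prefixCode t n)) 0) (∣n-n∣≡0 n) ⟩
      answer (prefixCode t n)
        ≡⟨ cong (λ c → suc (searchBelow evalApprox n c)) (interleavePrefix-prefixCode t e n) ⟩
      suc (dovetail evalApprox (interleave t e) n) ∎
      where open ≡-Reasoning
    silent : ∀ j → j < n → transposeName e (pair n (prefixCode t j)) ≡ 0
    silent j j<n = begin
      transposeName e (pair n (prefixCode t j))
        ≡⟨ at (prefixCode t j) ⟩
      ifz ∣ lengthCode (prefixCode t j) - n ∣ (answer (prefixCode t j)) 0
        ≡⟨ cong (λ L → ifz ∣ L - n ∣ (answer (prefixCode t j)) 0) (lengthCode-prefixCode t j) ⟩
      ifz ∣ j - n ∣ (answer (prefixCode t j)) 0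
        ≡⟨ ifz-≢0 (λ ∣j-n∣≡0 → <⇒≢ j<n (∣m-n∣≡0⇒m≡n ∣j-n∣≡0)) ⟩
      0 ∎
      where open ≡-Reasoning

  transposeAssociate : Baire
  transposeAssociate = toAssociate (prefixApprox unpair₁ transposeStep)

  transposeAssociate-computable : IsComputable transposeAssociate
  transposeAssociate-computable = toAssociate-computable (rec-prefixApprox rec-unpair₁ transposeStep⇓)
    where
    evalApprox⇓ : Recursive₂ evalApprox
    evalApprox⇓ = rec-apply (rec-apply (rec-constApprox ι⇓) rec-readEvens) rec-readOdds
    transposeStep⇓ : Recursive₂ transposeStep
    transposeStep⇓ =
      rec₂ (ap₃ rec-ifz (ap₂ rec-∣-∣ (ap₁ rec-lengthCode (ap₁ rec-unpair₂ var₀)) (ap₁ rec-unpair₁ var₀))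
                (ap₁ rec-suc (ap₂ (rec-searchBelow evalApprox⇓) (ap₁ rec-unpair₁ var₀)
                                  (ap₃ rec-interleavePrefix (ap₁ rec-unpair₁ var₀) (ap₁ rec-unpair₂ var₀) var₁)))
                (const 0))

  transposeAssociate-assoc : ∀ e → Assoc transposeAssociate e (transposeName e)
  transposeAssociate-assoc e = toAssociate-assoc (approx-prefixApprox unpair₁ transposeStep e)

private
  variable
    a₁ a₂ a₃ b₁ b₂ b₃ c₁ c₂ c₃ ℓ₁ ℓ₂ ℓ₃ ℓ₄ : Level

record NameExtensional (Z : RepSpace a₁ a₂ a₃) : Set (a₁ ⊔ˡ a₃) where
  field δ-resp-≗ : ∀ {p p′ x} → p ≗ p′ → δ Z p x → δ Z p′ x
open NameExtensional

OpenName-resp-≗ : (Z : RepSpace a₁ a₂ a₃) {U : Pred (Carrier Z) ℓ₁} {p p′ : Baire} →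
                  p ≗ p′ → OpenName Z U p → OpenName Z U p′
OpenName-resp-≗ Z p≗p′ named q z qz =
  let (r , pr , U⇒ , ⇒U) = named q z qz in r , Assoc-resp-≗-associate p≗p′ pr , U⇒ , ⇒U

𝒪-nameExtensional : (Z : RepSpace a₁ a₂ a₃) → NameExtensional (𝒪 Z)
𝒪-nameExtensional Z = record { δ-resp-≗ = λ {x = U} → OpenName-resp-≗ Z {U = proj₁ U} }

𝒱-nameExtensional : (Z : RepSpace a₁ a₂ a₃) → NameExtensional (𝒱 Z)
𝒱-nameExtensional Z =
  record { δ-resp-≗ = λ {x = V} → OpenName-resp-≗ (𝒪 Z) {U = Meets Z (proj₁ V)} }

computable-mono :
  {A : RepSpace a₁ a₂ a₃} {B : RepSpace b₁ b₂ b₃}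
  {dom : Pred (Carrier A) ℓ₁} {dom′ : Pred (Carrier A) ℓ₂}
  {R : Carrier A → Carrier B → Set ℓ₃} {R′ : Carrier A → Carrier B → Set ℓ₄} →
  (∀ x → dom′ x → dom x) → (∀ x y → dom′ x → R x y → R′ x y) →
  Computable A B dom R → Computable A B dom′ R′
computable-mono dom′⇒dom R⇒R′ (α , α⇓ , realise) =
  α , α⇓ , λ p x px dom′x →
    let (q , pq , y , qy , Rxy) = realise p x px (dom′⇒dom x dom′x)
    in q , pq , y , qy , R⇒R′ x y dom′x Rxy

computable-∘ :
  {A : RepSpace a₁ a₂ a₃} {B : RepSpace b₁ b₂ b₃} {C : RepSpace c₁ c₂ c₃}
  {domA : Pred (Carrier A) ℓ₁} {R : Carrier A → Carrier B → Set ℓ₂}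
  {domB : Pred (Carrier B) ℓ₃} {S : Carrier B → Carrier C → Set ℓ₄} →
  (∀ x y → domA x → R x y → domB y) →
  Computable A B domA R → Computable B C domB S →
  Computable A C domA (λ x z → Σ[ y ∈ Carrier B ] (R x y × S y z))
computable-∘ R⇒domB (α , α⇓ , f) (β , β⇓ , g) =
  let (γ , γ⇓ , γ-∘) = assoc-∘ α⇓ β⇓ in
  γ , γ⇓ , λ p x px domx →
    let (q , pq , y , qy , Rxy) = f p x px domx
        (r , qr , z , rz , Syz) = g q y qy (R⇒domB x y domx Rxy)
    in r , γ-∘ pq qr , z , rz , y , Rxy , Syz

computable-fst :
  {A : RepSpace a₁ a₂ a₃} {B : RepSpace b₁ b₂ b₃} {C : RepSpace c₁ c₂ c₃}
  {dom : Pred (Carrier A) ℓ₁} {R : Carrier A → Carrier C → Set ℓ₂} →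
  Computable A C dom R → Computable (A ⊗ B) C (λ xy → dom (proj₁ xy)) (λ xy → R (proj₁ xy))
computable-fst (α , α⇓ , f) =
  let (ε , ε⇓ , ε-evens) = assoc-evens
      (γ , γ⇓ , γ-∘) = assoc-∘ ε⇓ α⇓
  in γ , γ⇓ , λ { p (x , _) (px , _) domx →
                    let (q , pq , rest) = f (evens p) x px domx in q , γ-∘ (ε-evens p) pq , rest }

computable-snd :
  {A : RepSpace a₁ a₂ a₃} {B : RepSpace b₁ b₂ b₃} {C : RepSpace c₁ c₂ c₃}
  {dom : Pred (Carrier B) ℓ₁} {R : Carrier B → Carrier C → Set ℓ₂} →
  Computable B C dom R → Computable (A ⊗ B) C (λ xy → dom (proj₂ xy)) (λ xy → R (proj₂ xy))
computable-snd (α , α⇓ , f) =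
  let (ο , ο⇓ , ο-odds) = assoc-odds
      (γ , γ⇓ , γ-∘) = assoc-∘ ο⇓ α⇓
  in γ , γ⇓ , λ { p (_ , y) (_ , py) domy →
                    let (q , pq , rest) = f (odds p) y py domy in q , γ-∘ (ο-odds p) pq , rest }

computable-pair :
  {A : RepSpace a₁ a₂ a₃} {B : RepSpace b₁ b₂ b₃} {C : RepSpace c₁ c₂ c₃}
  {dom : Pred (Carrier A) ℓ₁} {R : Carrier A → Carrier B → Set ℓ₂} {S : Carrier A → Carrier C → Set ℓ₃} →
  NameExtensional B → NameExtensional C → Computable A B dom R → Computable A C dom S →
  Computable A (B ⊗ C) dom (λ x yz → R x (proj₁ yz) × S x (proj₂ yz))
computable-pair B-ext C-ext (α , α⇓ , f) (β , β⇓ , g) =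
  let (γ , γ⇓ , γ-pair) = assoc-interleave α⇓ β⇓ in
  γ , γ⇓ , λ p x px domx →
    let (q , pq , y , qy , Rxy) = f p x px domx
        (r , pr , z , rz , Sxz) = g p x px domx
    in interleave q r , γ-pair pq pr , (y , z) ,
       (δ-resp-≗ B-ext (λ n → sym (evens-interleave q r n)) qy ,
        δ-resp-≗ C-ext (λ n → sym (odds-interleave q r n)) rz) ,
       Rxy , Sxz

module BaseNeighbourhoods {c ℓ d b e} (X : RepSpace c ℓ d) (P : Pred (Carrier (𝒪 X)) b)
                          (β : Baire → Σ (Carrier (𝒪 X)) P → Set e) where

  𝔅 : RepSpace (lsuc (c ⊔ˡ ℓ ⊔ˡ d) ⊔ˡ b) (c ⊔ˡ ℓ ⊔ˡ d) e
  𝔅 = BaseSpace X P β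

  Covers : Carrier (𝒪 X) → Carrier (𝒱 𝔅) → Set (lsuc (c ⊔ˡ ℓ ⊔ˡ d) ⊔ˡ b ⊔ˡ e)
  Covers O A = ∀ x → (proj₁ O x → Σ[ B ∈ Carrier 𝔅 ] (proj₁ A B × proj₁ (proj₁ B) x))
                   × (Σ[ B ∈ Carrier 𝔅 ] (proj₁ A B × proj₁ (proj₁ B) x) → proj₁ O x)

  NeighbourhoodsOf : Carrier X → Carrier (𝒪 𝔅) → Set (lsuc (c ⊔ˡ ℓ ⊔ˡ d) ⊔ˡ b ⊔ˡ e)
  NeighbourhoodsOf x U = ∀ B → (proj₁ U B → proj₁ (proj₁ B) x) × (proj₁ (proj₁ B) x → proj₁ U B)

  Around : Carrier X → Pred (Carrier 𝔅) (lsuc (c ⊔ˡ ℓ ⊔ˡ d) ⊔ˡ b ⊔ˡ e)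
  Around x B = Lift (lsuc (c ⊔ˡ ℓ ⊔ˡ d) ⊔ˡ b ⊔ˡ e) (proj₁ (proj₁ B) x)

  pointNeighbourhoods : Computable 𝔅 (𝒪 X) (λ _ → ⊤) (λ B U → _≈_ (𝒪 X) (proj₁ B) U) →
                        Computable X (𝒪 𝔅) (λ _ → ⊤) NeighbourhoodsOf
  pointNeighbourhoods (ι , ι⇓ , inclusion) =
    transposeAssociate , transposeAssociate-computable ,
    λ ξ x ξx _ → transposeName ξ , transposeAssociate-assoc ξ , neighbourhoods ξ x ξx , names ξ x ξx ,
                 λ _ → lower , lift
    where
    open Transpose ι (recursive ι⇓)
    names : ∀ ξ x → δ X ξ x → OpenName 𝔅 (Around x) (transposeName ξ)
    names ξ x ξx t B tB =
      let (u , tu , U , uU , B≈U) = inclusion t B tB tt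
          (r , ur , U⇒ , ⇒U) = uU ξ x ξx
          approx-r = approx-evalApprox tu ur
      in dovetail evalApprox (interleave t ξ) , transposeName-assoc t ξ ,
         (λ Bx → Sier-dovetail⇐ approx-r (U⇒ (proj₁ (B≈U x) (lower Bx)))) ,
         (λ s → lift (proj₂ (B≈U x) (⇒U (Sier-dovetail⇒ approx-r s))))
    neighbourhoods : ∀ ξ x → δ X ξ x → Carrier (𝒪 𝔅)
    neighbourhoods ξ x ξx =
      Around x , (λ B≈B′ Bx → lift (proj₁ (B≈B′ x) (lower Bx))) , transposeName ξ , names ξ x ξx

  covering-meets-neighbourhoods :
    ∀ (xO : Carrier (X ⊗ 𝒪 X)) (AU : Carrier (𝒱 𝔅 ⊗ 𝒪 𝔅)) → proj₁ (proj₂ xO) (proj₁ xO) →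
    Covers (proj₂ xO) (proj₁ AU) × NeighbourhoodsOf (proj₁ xO) (proj₂ AU) →
    Σ[ B ∈ Carrier 𝔅 ] (proj₁ (proj₁ AU) B × proj₁ (proj₂ AU) B)
  covering-meets-neighbourhoods (x , _) _ x∈O (cover , nbhd) =
    let (B , AB , Bx) = proj₁ (cover x) x∈O in B , AB , proj₂ (nbhd B) Bx

  chosen-neighbourhood :
    ∀ (xO : Carrier (X ⊗ 𝒪 X)) (B : Carrier 𝔅) → proj₁ (proj₂ xO) (proj₁ xO) →
    Σ[ AU ∈ Carrier (𝒱 𝔅 ⊗ 𝒪 𝔅) ] ((Covers (proj₂ xO) (proj₁ AU) × NeighbourhoodsOf (proj₁ xO) (proj₂ AU))
                                    × (proj₁ (proj₁ AU) B × proj₁ (proj₂ AU) B)) →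
    proj₁ (proj₁ B) (proj₁ xO) × (∀ y → proj₁ (proj₁ B) y → proj₁ (proj₂ xO) y)
  chosen-neighbourhood _ B _ (_ , (cover , nbhd) , (AB , UB)) =
    proj₁ (nbhd B) UB , λ y By → proj₂ (cover y) (B , AB , By)

proposition4p5 : ∀ {c ℓ d b e} (X : RepSpace c ℓ d) (P : Pred (Carrier (𝒪 X)) b)
    (β : Baire → Σ (Carrier (𝒪 X)) P → Set e) →
    IsRepresentation X →
    Respects (𝒪 X) P →
    IsRepresentation (BaseSpace X P β) →
    LacombeBase X P β →
    OVCComputable (BaseSpace X P β) →
    NoginaBase X P β
proposition4p5 X P β _ _ _ (semiEffective , unionInverse) ovc = semiEffective , nogina
  where
  open BaseNeighbourhoods X P β
  coverAndNeighbourhoods : Computable (X ⊗ 𝒪 X) (𝒱 𝔅 ⊗ 𝒪 𝔅) (λ _ → ⊤)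
                             (λ xO AU → Covers (proj₂ xO) (proj₁ AU) × NeighbourhoodsOf (proj₁ xO) (proj₂ AU))
  coverAndNeighbourhoods =
    computable-pair {A = X ⊗ 𝒪 X} {B = 𝒱 𝔅} {C = 𝒪 𝔅} (𝒱-nameExtensional 𝔅) (𝒪-nameExtensional 𝔅)
      (computable-snd {A = X} {B = 𝒪 X} {C = 𝒱 𝔅} unionInverse)
      (computable-fst {A = X} {B = 𝒪 X} {C = 𝒪 𝔅} (pointNeighbourhoods (proj₁ semiEffective)))
  nogina : Computable (X ⊗ 𝒪 X) 𝔅 (λ xO → proj₁ (proj₂ xO) (proj₁ xO))
             (λ xO B → proj₁ (proj₁ B) (proj₁ xO) × (∀ y → proj₁ (proj₁ B) y → proj₁ (proj₂ xO) y))
  nogina =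
    computable-mono {A = X ⊗ 𝒪 X} {B = 𝔅} (λ _ x∈O → x∈O) chosen-neighbourhood
      (computable-∘ {A = X ⊗ 𝒪 X} {B = 𝒱 𝔅 ⊗ 𝒪 𝔅} {C = 𝔅} covering-meets-neighbourhoods
        (computable-mono {A = X ⊗ 𝒪 X} {B = 𝒱 𝔅 ⊗ 𝒪 𝔅} (λ _ _ → tt) (λ _ _ _ R → R) coverAndNeighbourhoods)
        ovc)
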